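{- For $n\ge 18$, every $n\times n$ dissimilarity matrix with entries in $\{0,1\}$ has star tree rank at most $n-3$.
   Context: An $n\times n$ dissimilarity matrix is a function from 2-element subsets of $[n]$ to $\mathbb{R}$. A star tree matrix is one of the form $(v_i+v_j)_{i\ne j}$ for $v\in\mathbb{R}^n$; the star tree rank of $M$ is the least $r$ such that $M$ is the entrywise minimum of $r$ star tree matrices. -}

module Defs where

open import Data.Nat using (ℕ; suc; _≤_)
open import Data.Fin using (Fin)
open import Data.Bool using (Bool; true; false)
open import Data.Rational using (ℚ; 0ℚ; 1ℚ; _+_; _≤_)
open import Data.Product using (Σ; ∃; ∃-syntax; _×_)
open import Relation.Binary.PropositionalEquality using (_≡_; _≢_)

-- An n×n dissimilarity matrix: a function on 2-element subsets of [n],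
-- represented as a symmetric function on ordered pairs of distinct indices
-- (values on the diagonal are irrelevant and never inspected).
record DissimilarityMatrix (A : Set) (n : ℕ) : Set where
  field
    entry : Fin n → Fin n → A
    symmetric : ∀ i j → i ≢ j → entry i j ≡ entry j i
open DissimilarityMatrix public

bit : Bool → ℚ
bit false = 0ℚ
bit true  = 1ℚ

starTree : {n : ℕ} → (Fin n → ℚ) → Fin n → Fin n → ℚ
starTree v i j = v i + v j

-- M (off-diagonal) is the entrywise minimum of the r star tree matrices
-- given by the vectors vs k, k : Fin r  (r ≥ 1 so that the minimum exists).
IsMinOfStarTrees : {n : ℕ} (r : ℕ) → (Fin r → Fin n → ℚ) → (Fin n → Fin n → ℚ) → Set
IsMinOfStarTrees {n} r vs M =
  ∀ (i j : Fin n) → i ≢ j →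
    (∀ (k : Fin r) → M i j Data.Rational.≤ starTree (vs k) i j)
    × (∃[ k ] (M i j ≡ starTree (vs k) i j))

StarTreeRankAtMost : {n : ℕ} → (Fin n → Fin n → ℚ) → ℕ → Set
StarTreeRankAtMost {n} M s =
  ∃[ r ] (1 Data.Nat.≤ r × r Data.Nat.≤ s × ∃[ vs ] IsMinOfStarTrees {n} r vs M)

toℚ : {n : ℕ} → DissimilarityMatrix Bool n → Fin n → Fin n → ℚ
toℚ D i j = bit (entry D i j)

{-# OPTIONS --safe #-}
-- Once n ≥ 12, Ramsey's theorem gives four points on which D is a single star tree matrix: a centre at
-- constant distance from three points at constant mutual distance (take the six points joined to a fixed
-- vertex in its majority colour, and a monochromatic triangle among them, R(3,3) = 6).
-- Every other vertex p then costs one more star tree: the vector with -½ at p and ½ + D(p,i) at i realises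
-- row p exactly and is ≥ 1 away from p, while each old vector is extended by 3/2 at p, which never
-- undercuts row p because all vectors are kept ≥ -½.
module Submission where

open import Defs
open import Data.Bool using (Bool; true; false; not)
open import Data.Bool.Properties using (¬-not) renaming (_≟_ to _≟ᵇ_)
open import Data.Fin using (Fin; zero; suc; punchIn; punchOut)
open import Data.List using (List; []; _∷_; length; filter; tabulate)
open import Data.List.Properties using (length-tabulate)
open import Data.List.Membership.Propositional using (_∈_)
open import Data.List.Membership.Propositional.Properties using (∈-filter⁻)
open import Data.List.Relation.Unary.Any using (here; there)
open import Data.List.Relation.Unary.All as All using (All)
open import Data.List.Relation.Unary.AllPairs as AllPairs using (_∷_)
open import Data.List.Relation.Unary.Unique.Propositional using (Unique)
open import Data.List.Relation.Unary.Unique.Propositional.Properties using (allFin⁺; filter⁺)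
open import Data.Fin.Properties
  using (_≟_; punchIn-punchOut; punchOut-injective; punchIn-injective; punchInᵢ≢i; injective⇒≤;
         any?; all?; ¬∀⟶∃¬; ¬Fin0)
open import Data.Nat as ℕ using (ℕ; zero; suc; _+_; _≤_; _∸_; s≤s)
open import Data.Nat.Properties as ℕ using ()
open import Data.Product using (Σ-syntax; _×_; _,_; proj₁; proj₂; ∃; ∃-syntax)
open import Data.Rational as ℚ using (ℚ; 0ℚ; 1ℚ; ½; -½)
open import Data.Rational.Properties as ℚ using ()
open import Data.Sum using (_⊎_; inj₁; inj₂)
open import Data.Vec as Vec using (Vec; lookup)
open import Data.Vec.Relation.Unary.All as VecAll using ()
open import Data.Vec.Relation.Unary.AllPairs as VecAllPairs using ()
open import Data.Vec.Relation.Unary.Unique.Propositional.Properties using (lookup-injective)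
open import Data.Vec.Functional using (insertAt)
open import Data.Vec.Functional.Properties using (insertAt-lookup; insertAt-punchIn)
open import Function.Definitions using (Injective)
open import Relation.Binary.PropositionalEquality
open import Relation.Nullary using (yes; no; contradiction)
open import Relation.Nullary.Decidable using (True; toWitness)

private
  variable
    n m r : ℕ

≤-by-decision : {p q : ℚ} {p≤q : True (p ℚ.≤? q)} → p ℚ.≤ q
≤-by-decision {p≤q = p≤q} = toWitness p≤q

threeHalves : ℚ
threeHalves = 1ℚ ℚ.+ ½

halfBit : Bool → ℚ
halfBit false = 0ℚ
halfBit true  = ½

0≤bit : ∀ b → 0ℚ ℚ.≤ bit b
0≤bit false = ℚ.≤-refl
0≤bit true  = ℚ.nonNegative⁻¹ 1ℚ

bit≤1 : ∀ b → bit b ℚ.≤ 1ℚ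
bit≤1 false = ℚ.nonNegative⁻¹ 1ℚ
bit≤1 true  = ℚ.≤-refl

-½+[½+bit]≡bit : ∀ b → -½ ℚ.+ (½ ℚ.+ bit b) ≡ bit b
-½+[½+bit]≡bit false = refl
-½+[½+bit]≡bit true  = refl

-½≤½+bit : ∀ b → -½ ℚ.≤ ½ ℚ.+ bit b
-½≤½+bit b = ℚ.≤-trans ≤-by-decision (ℚ.+-monoʳ-≤ ½ (0≤bit b))

1≤[½+bit]+[½+bit] : ∀ b c → 1ℚ ℚ.≤ (½ ℚ.+ bit b) ℚ.+ (½ ℚ.+ bit c)
1≤[½+bit]+[½+bit] b c = ℚ.+-mono-≤ (ℚ.+-monoʳ-≤ ½ (0≤bit b)) (ℚ.+-monoʳ-≤ ½ (0≤bit c))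

bit≤threeHalves+ : ∀ b {w} → -½ ℚ.≤ w → bit b ℚ.≤ threeHalves ℚ.+ w
bit≤threeHalves+ b -½≤w = ℚ.≤-trans (bit≤1 b) (ℚ.+-monoʳ-≤ threeHalves -½≤w)

halfBit+halfBit≡bit : ∀ b → halfBit b ℚ.+ halfBit b ≡ bit b
halfBit+halfBit≡bit false = refl
halfBit+halfBit≡bit true  = refl

[bit-halfBit]+halfBit≡bit : ∀ a b → (bit a ℚ.- halfBit b) ℚ.+ halfBit b ≡ bit a
[bit-halfBit]+halfBit≡bit false false = refl
[bit-halfBit]+halfBit≡bit false true  = refl
[bit-halfBit]+halfBit≡bit true  false = refl
[bit-halfBit]+halfBit≡bit true  true  = refl

-½≤halfBit : ∀ b → -½ ℚ.≤ halfBit b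
-½≤halfBit false = ≤-by-decision
-½≤halfBit true  = ≤-by-decision

-½≤bit-halfBit : ∀ a b → -½ ℚ.≤ bit a ℚ.- halfBit b
-½≤bit-halfBit false false = ≤-by-decision
-½≤bit-halfBit false true  = ≤-by-decision
-½≤bit-halfBit true  false = ≤-by-decision
-½≤bit-halfBit true  true  = ≤-by-decision

delete : {A : Set} → DissimilarityMatrix A (suc n) → Fin (suc n) → DissimilarityMatrix A n
entry (delete D p) i j = entry D (punchIn p i) (punchIn p j)
symmetric (delete D p) i j i≢j = symmetric D _ _ (λ eq → i≢j (punchIn-injective p i j eq))

data PunchView (p : Fin (suc n)) : Fin (suc n) → Set where
  at      : PunchView p p
  punched : (j : Fin n) → PunchView p (punchIn p j)

punchView : (p i : Fin (suc n)) → PunchView p i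
punchView p i with p ≟ i
... | yes refl = at
... | no p≢i   = subst (PunchView p) (punchIn-punchOut p≢i) (punched (punchOut p≢i))

starTree-insertAt-at : (v : Fin n → ℚ) (p : Fin (suc n)) (x : ℚ) (j : Fin n) →
  starTree (insertAt v p x) p (punchIn p j) ≡ x ℚ.+ v j
starTree-insertAt-at v p x j = cong₂ ℚ._+_ (insertAt-lookup v p x) (insertAt-punchIn v p x j)

starTree-insertAt-punchIn : (v : Fin n → ℚ) (p : Fin (suc n)) (x : ℚ) (i j : Fin n) →
  starTree (insertAt v p x) (punchIn p i) (punchIn p j) ≡ starTree v i j
starTree-insertAt-punchIn v p x i j = cong₂ ℚ._+_ (insertAt-punchIn v p x i) (insertAt-punchIn v p x j)

MinOfStarTreesAt : (Fin r → Fin n → ℚ) → (Fin n → Fin n → ℚ) → Fin n → Fin n → Set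
MinOfStarTreesAt {r} vs M i j =
  (∀ (k : Fin r) → M i j ℚ.≤ starTree (vs k) i j) × (∃[ k ] (M i j ≡ starTree (vs k) i j))

MinOfStarTreesAt-swap : {vs : Fin r → Fin n → ℚ} {M : Fin n → Fin n → ℚ} {i j : Fin n} →
  M i j ≡ M j i → MinOfStarTreesAt vs M i j → MinOfStarTreesAt vs M j i
MinOfStarTreesAt-swap {vs = vs} {i = i} {j} Mij≡Mji (below , k , attained) =
  (λ k → subst₂ ℚ._≤_ Mij≡Mji (swap k) (below k)) , k , trans (sym Mij≡Mji) (trans attained (swap k))
  where
  swap : ∀ k → starTree (vs k) i j ≡ starTree (vs k) j i
  swap k = ℚ.+-comm (vs k i) (vs k j)

record BoundedStarCover (r : ℕ) (M : Fin n → Fin n → ℚ) : Set where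
  field
    trees   : Fin r → Fin n → ℚ
    isMin   : IsMinOfStarTrees r trees M
    bounded : ∀ k i → -½ ℚ.≤ trees k i

addVertex : (D : DissimilarityMatrix Bool (suc n)) (p : Fin (suc n)) →
  BoundedStarCover r (toℚ (delete D p)) → BoundedStarCover (suc r) (toℚ D)
addVertex {n} {r} D p cover = record { trees = trees ; isMin = isMin ; bounded = bounded }
  where
  module C = BoundedStarCover cover

  row : Fin n → ℚ
  row j = ½ ℚ.+ bit (entry D p (punchIn p j))

  trees : Fin (suc r) → Fin (suc n) → ℚ
  trees zero    = insertAt row p -½
  trees (suc k) = insertAt (C.trees k) p threeHalves

  atVertex : ∀ j → MinOfStarTreesAt trees (toℚ D) p (punchIn p j)
  atVertex j = below , zero , sym exact
    where
    e = entry D p (punchIn p j)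
    exact : starTree (trees zero) p (punchIn p j) ≡ bit e
    exact = trans (starTree-insertAt-at row p -½ j) (-½+[½+bit]≡bit e)
    below : ∀ k → bit e ℚ.≤ starTree (trees k) p (punchIn p j)
    below zero    = ℚ.≤-reflexive (sym exact)
    below (suc k) = begin
      bit e                                    ≤⟨ bit≤threeHalves+ e (C.bounded k j) ⟩
      threeHalves ℚ.+ C.trees k j              ≡⟨ sym (starTree-insertAt-at (C.trees k) p threeHalves j) ⟩
      starTree (trees (suc k)) p (punchIn p j) ∎
      where open ℚ.≤-Reasoning

  awayFromVertex : ∀ i j → i ≢ j → MinOfStarTreesAt trees (toℚ D) (punchIn p i) (punchIn p j)
  awayFromVertex i j i≢j with C.isMin i j i≢j
  ... | oldBelow , k₀ , attained =
    below , suc k₀ , trans attained (sym (starTree-insertAt-punchIn (C.trees k₀) p threeHalves i j))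
    where
    open ℚ.≤-Reasoning
    e = entry D (punchIn p i) (punchIn p j)
    below : ∀ k → bit e ℚ.≤ starTree (trees k) (punchIn p i) (punchIn p j)
    below zero    = begin
      bit e                                                ≤⟨ bit≤1 e ⟩
      1ℚ                                                   ≤⟨ 1≤[½+bit]+[½+bit] (entry D p (punchIn p i))
                                                                                (entry D p (punchIn p j)) ⟩
      row i ℚ.+ row j                                      ≡⟨ sym (starTree-insertAt-punchIn row p -½ i j) ⟩
      starTree (trees zero) (punchIn p i) (punchIn p j)    ∎
    below (suc k) = begin
      bit e                                                ≤⟨ oldBelow k ⟩
      starTree (C.trees k) i j                             ≡⟨ sym (starTree-insertAt-punchIn (C.trees k) p threeHalves i j) ⟩
      starTree (trees (suc k)) (punchIn p i) (punchIn p j) ∎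

  isMin : IsMinOfStarTrees (suc r) trees (toℚ D)
  isMin i j i≢j with punchView p i | punchView p j
  ... | at         | at         = contradiction refl i≢j
  ... | at         | punched j′ = atVertex j′
  ... | punched i′ | at         = MinOfStarTreesAt-swap {vs = trees} {M = toℚ D}
                                    (cong bit (symmetric D _ _ (λ eq → i≢j (sym eq)))) (atVertex i′)
  ... | punched i′ | punched j′ = awayFromVertex i′ j′ (λ eq → i≢j (cong (punchIn p) eq))

  bounded : ∀ k i → -½ ℚ.≤ trees k i
  bounded zero    i with punchView p i
  ... | at         = ℚ.≤-reflexive (sym (insertAt-lookup row p -½))
  ... | punched j  = subst (-½ ℚ.≤_) (sym (insertAt-punchIn row p -½ j)) (-½≤½+bit (entry D p (punchIn p j)))
  bounded (suc k) i with punchView p i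
  ... | at         = subst (-½ ℚ.≤_) (sym (insertAt-lookup (C.trees k) p threeHalves)) ≤-by-decision
  ... | punched j  = subst (-½ ℚ.≤_) (sym (insertAt-punchIn (C.trees k) p threeHalves j)) (C.bounded k j)

exactStarTree : (v : Fin n → ℚ) {M : Fin n → Fin n → ℚ} →
  (∀ i j → i ≢ j → M i j ≡ starTree v i j) → IsMinOfStarTrees 1 (λ _ → v) M
exactStarTree v exact i j i≢j = (λ _ → ℚ.≤-reflexive (exact i j i≢j)) , zero , exact i j i≢j

uniformStarCover : (D : DissimilarityMatrix Bool (suc n)) (a : Fin (suc n)) {spoke rim : Bool} →
  (∀ j → entry D a (punchIn a j) ≡ spoke) → (∀ i j → i ≢ j → entry (delete D a) i j ≡ rim) →
  BoundedStarCover 1 (toℚ D)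
uniformStarCover {n} D a {spoke} {rim} spoke-colour rim-colour =
  record { trees = λ _ → v ; isMin = exactStarTree v exact ; bounded = λ _ → bounded }
  where
  v : Fin (suc n) → ℚ
  v = insertAt (λ _ → halfBit rim) a (bit spoke ℚ.- halfBit rim)

  exactAtCentre : ∀ j → toℚ D a (punchIn a j) ≡ starTree v a (punchIn a j)
  exactAtCentre j = begin
    bit (entry D a (punchIn a j))         ≡⟨ cong bit (spoke-colour j) ⟩
    bit spoke                             ≡⟨ sym ([bit-halfBit]+halfBit≡bit spoke rim) ⟩
    (bit spoke ℚ.- halfBit rim) ℚ.+ halfBit rim ≡⟨ sym (starTree-insertAt-at (λ _ → halfBit rim) a _ j) ⟩
    starTree v a (punchIn a j)            ∎
    where open ≡-Reasoning

  exactOnRim : ∀ i j → i ≢ j → toℚ D (punchIn a i) (punchIn a j) ≡ starTree v (punchIn a i) (punchIn a j)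
  exactOnRim i j i≢j = begin
    bit (entry D (punchIn a i) (punchIn a j)) ≡⟨ cong bit (rim-colour i j i≢j) ⟩
    bit rim                                   ≡⟨ sym (halfBit+halfBit≡bit rim) ⟩
    halfBit rim ℚ.+ halfBit rim               ≡⟨ sym (starTree-insertAt-punchIn (λ _ → halfBit rim) a _ i j) ⟩
    starTree v (punchIn a i) (punchIn a j)    ∎
    where open ≡-Reasoning

  exact : ∀ i j → i ≢ j → toℚ D i j ≡ starTree v i j
  exact i j i≢j with punchView a i | punchView a j
  ... | at         | at         = contradiction refl i≢j
  ... | at         | punched j′ = exactAtCentre j′
  ... | punched i′ | at         =
    trans (cong bit (symmetric D _ _ i≢j)) (trans (exactAtCentre i′) (ℚ.+-comm (v a) (v (punchIn a i′))))
  ... | punched i′ | punched j′ = exactOnRim i′ j′ (λ eq → i≢j (cong (punchIn a) eq))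

  bounded : ∀ i → -½ ℚ.≤ v i
  bounded i with punchView a i
  ... | at        = subst (-½ ℚ.≤_) (sym (insertAt-lookup _ a _)) (-½≤bit-halfBit spoke rim)
  ... | punched j = subst (-½ ℚ.≤_) (sym (insertAt-punchIn _ a _ j)) (-½≤halfBit rim)

record UniformStar (D : DissimilarityMatrix Bool n) (m : ℕ) : Set where
  field
    vertex           : Fin (suc m) → Fin n
    vertex-injective : Injective _≡_ _≡_ vertex
    spoke rim        : Bool
    spoke-colour     : ∀ t → entry D (vertex zero) (vertex (suc t)) ≡ spoke
    rim-colour       : ∀ s t → s ≢ t → entry D (vertex (suc s)) (vertex (suc t)) ≡ rim

ontoOrAvoids : (q : Fin m → Fin n) → (∀ x → ∃ λ t → q t ≡ x) ⊎ (∃ λ x → ∀ t → x ≢ q t)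
ontoOrAvoids q with all? (λ x → any? (λ t → q t ≟ x))
... | yes onto = inj₁ onto
... | no ¬onto with ¬∀⟶∃¬ _ _ (λ x → any? (λ t → q t ≟ x)) ¬onto
...   | x , x∉image = inj₂ (x , λ t x≡qt → x∉image (t , sym x≡qt))

onto⇒≤ : (q : Fin m → Fin n) → (∀ x → ∃ λ t → q t ≡ x) → n ≤ m
onto⇒≤ q onto = injective⇒≤ {f = λ x → proj₁ (onto x)}
  (λ {x} {y} eq → trans (sym (proj₂ (onto x))) (trans (cong q eq) (proj₂ (onto y))))

entry-delete-punchOut : {A : Set} (D : DissimilarityMatrix A (suc n)) {p i j : Fin (suc n)}
  (p≢i : p ≢ i) (p≢j : p ≢ j) → entry (delete D p) (punchOut p≢i) (punchOut p≢j) ≡ entry D i j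
entry-delete-punchOut D p≢i p≢j = cong₂ (entry D) (punchIn-punchOut p≢i) (punchIn-punchOut p≢j)

UniformStar-delete : {D : DissimilarityMatrix Bool (suc n)} (S : UniformStar D m) (p : Fin (suc n)) →
  (∀ t → p ≢ UniformStar.vertex S t) → UniformStar (delete D p) m
UniformStar-delete {D = D} S p p∉S = record
  { vertex           = λ t → punchOut (p∉S t)
  ; vertex-injective = λ eq → vertex-injective (punchOut-injective (p∉S _) (p∉S _) eq)
  ; spoke            = spoke
  ; rim              = rim
  ; spoke-colour     = λ t → trans (entry-delete-punchOut D (p∉S zero) (p∉S (suc t))) (spoke-colour t)
  ; rim-colour       = λ s t s≢t →
      trans (entry-delete-punchOut D (p∉S (suc s)) (p∉S (suc t))) (rim-colour s t s≢t)
  }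
  where open UniformStar S

spanning⇒singleStarCover : (D : DissimilarityMatrix Bool (suc n)) (S : UniformStar D m) →
  (∀ x → ∃ λ t → UniformStar.vertex S t ≡ x) → BoundedStarCover 1 (toℚ D)
spanning⇒singleStarCover D S onto = uniformStarCover D centre spokes rims
  where
  open UniformStar S
  centre = vertex zero

  leaf : ∀ j → ∃ λ t → vertex (suc t) ≡ punchIn centre j
  leaf j with onto (punchIn centre j)
  ... | zero  , eq = contradiction (sym eq) (punchInᵢ≢i centre j)
  ... | suc t , eq = t , eq

  spokes : ∀ j → entry D centre (punchIn centre j) ≡ spoke
  spokes j = subst (λ x → entry D centre x ≡ spoke) (proj₂ (leaf j)) (spoke-colour (proj₁ (leaf j)))

  rims : ∀ i j → i ≢ j → entry D (punchIn centre i) (punchIn centre j) ≡ rim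
  rims i j i≢j with leaf i | leaf j
  ... | s , eqs | t , eqt = subst₂ (λ x y → entry D x y ≡ rim) eqs eqt (rim-colour s t s≢t)
    where
    s≢t : s ≢ t
    s≢t s≡t = i≢j (punchIn-injective centre i j (trans (sym eqs) (trans (cong (λ u → vertex (suc u)) s≡t) eqt)))

boundedStarCover : (D : DissimilarityMatrix Bool n) → UniformStar D m → BoundedStarCover (n ∸ m) (toℚ D)
boundedStarCover {zero}      D S = contradiction (UniformStar.vertex S zero) ¬Fin0
boundedStarCover {suc n} {m} D S with ontoOrAvoids (UniformStar.vertex S)
... | inj₁ onto = subst (λ r → BoundedStarCover r (toℚ D)) (sym [1+n]∸m≡1) (spanning⇒singleStarCover D S onto)
  where
  n≡m : n ≡ m
  n≡m = ℕ.suc-injective (ℕ.≤-antisym (onto⇒≤ _ onto) (injective⇒≤ (UniformStar.vertex-injective S)))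
  [1+n]∸m≡1 : suc n ∸ m ≡ 1
  [1+n]∸m≡1 = trans (cong (λ k → suc k ∸ m) n≡m) (ℕ.m+n∸n≡m 1 m)
... | inj₂ (p , p∉S) =
  subst (λ r → BoundedStarCover r (toℚ D)) (sym (ℕ.+-∸-assoc 1 m≤n))
        (addVertex D p (boundedStarCover (delete D p) S′))
  where
  S′ = UniformStar-delete S p p∉S
  m≤n : m ≤ n
  m≤n = ℕ.<⇒≤ (injective⇒≤ (UniformStar.vertex-injective S′))

module _ {V : Set} where

  length-filter-colours : (f : V → Bool) (xs : List V) →
    length (filter (λ y → f y ≟ᵇ true) xs) + length (filter (λ y → f y ≟ᵇ false) xs) ≡ length xs
  length-filter-colours f []       = refl
  length-filter-colours f (x ∷ xs) with f x
  ... | true  = cong suc (length-filter-colours f xs)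
  ... | false = trans (ℕ.+-suc _ _) (cong suc (length-filter-colours f xs))

  colourClass : (f : V → Bool) (xs : List V) {k : ℕ} → suc (k + k) ≤ length xs →
    ∃[ b ] suc k ≤ length (filter (λ y → f y ≟ᵇ b) xs)
  colourClass f xs {k} 2k+1≤xs
    with suc k ℕ.≤? length (filter (λ y → f y ≟ᵇ true) xs)
       | suc k ℕ.≤? length (filter (λ y → f y ≟ᵇ false) xs)
  ... | yes long | _        = true , long
  ... | no _     | yes long = false , long
  ... | no short | no short′ = contradiction 2k+1≤xs (ℕ.<⇒≱ (begin-strict
    length xs                                   ≡⟨ sym (length-filter-colours f xs) ⟩
    length (filter _ xs) + length (filter _ xs) ≤⟨ ℕ.+-mono-≤ (ℕ.s≤s⁻¹ (ℕ.≰⇒> short)) (ℕ.s≤s⁻¹ (ℕ.≰⇒> short′)) ⟩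
    k + k                                       <⟨ ℕ.n<1+n (k + k) ⟩
    suc (k + k)                                 ∎))
    where open ℕ.≤-Reasoning

  record Triple (P : V → Set) : Set where
    field
      x y z       : V
      x≢y         : x ≢ y
      x≢z         : x ≢ z
      y≢z         : y ≢ z
      Px          : P x
      Py          : P y
      Pz          : P z

  Monochromatic : {P : V → Set} → (V → V → Bool) → Bool → Triple P → Set
  Monochromatic c b T = c x y ≡ b × c x z ≡ b × c y z ≡ b
    where open Triple T

  threeMembers : (L : List V) → Unique L → 3 ≤ length L → Triple (_∈ L)
  threeMembers (x ∷ y ∷ z ∷ _) ((x≢y All.∷ x≢z All.∷ _) ∷ (y≢z All.∷ _) ∷ _) _ = record
    { x = x ; y = y ; z = z ; x≢y = x≢y ; x≢z = x≢z ; y≢z = y≢z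
    ; Px = here refl ; Py = there (here refl) ; Pz = there (there (here refl)) }
  threeMembers (_ ∷ _ ∷ []) _ (s≤s (s≤s ()))
  threeMembers (_ ∷ [])     _ (s≤s ())
  threeMembers []           _ ()

  ramsey33 : (c : V → V → Bool) (L : List V) → Unique L → 6 ≤ length L →
    ∃[ b ] Σ[ T ∈ Triple (_∈ L) ] Monochromatic c b T
  ramsey33 c (a ∷ rest) (a∉rest ∷ rest-unique) (s≤s 5≤rest) with colourClass (c a) rest 5≤rest
  ... | b , 3≤neighbours = triangle
    where
    neighbours = filter (λ w → c a w ≟ᵇ b) rest
    open Triple (threeMembers neighbours (filter⁺ _ rest-unique) 3≤neighbours)

    neighbour : ∀ {w} → w ∈ neighbours → w ∈ a ∷ rest × a ≢ w × c a w ≡ b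
    neighbour w∈ = let (w∈rest , caw≡b) = ∈-filter⁻ (λ w → c a w ≟ᵇ b) w∈
                   in there w∈rest , All.lookup a∉rest w∈rest , caw≡b

    withApex : ∀ {u v} → u ∈ neighbours → v ∈ neighbours → u ≢ v → c u v ≡ b →
      ∃[ b ] Σ[ T ∈ Triple (_∈ a ∷ rest) ] Monochromatic c b T
    withApex u∈ v∈ u≢v cuv≡b =
      let (u∈L , a≢u , cau≡b) = neighbour u∈ ; (v∈L , a≢v , cav≡b) = neighbour v∈ in
      b , record { x = a ; y = _ ; z = _ ; x≢y = a≢u ; x≢z = a≢v ; y≢z = u≢v
                 ; Px = here refl ; Py = u∈L ; Pz = v∈L } , cau≡b , cav≡b , cuv≡b

    triangle : ∃[ b ] Σ[ T ∈ Triple (_∈ a ∷ rest) ] Monochromatic c b T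
    triangle with c x y ≟ᵇ b | c x z ≟ᵇ b | c y z ≟ᵇ b
    ... | yes cxy≡b | _         | _         = withApex Px Py x≢y cxy≡b
    ... | no _      | yes cxz≡b | _         = withApex Px Pz x≢z cxz≡b
    ... | no _      | no _      | yes cyz≡b = withApex Py Pz y≢z cyz≡b
    ... | no cxy≢b  | no cxz≢b  | no cyz≢b  =
      not b , record { x = x ; y = y ; z = z ; x≢y = x≢y ; x≢z = x≢z ; y≢z = y≢z
                     ; Px = proj₁ (neighbour Px) ; Py = proj₁ (neighbour Py) ; Pz = proj₁ (neighbour Pz) }
            , ¬-not cxy≢b , ¬-not cxz≢b , ¬-not cyz≢b

12≤n⇒uniformStar : 12 ≤ n → (D : DissimilarityMatrix Bool n) → UniformStar D 3
12≤n⇒uniformStar {suc n} (s≤s 11≤n) D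
  with colourClass (entry D zero) (tabulate suc) (subst (11 ≤_) (sym (length-tabulate suc)) 11≤n)
... | χ , 6≤class
  with ramsey33 (entry D) (filter (λ w → entry D zero w ≟ᵇ χ) (tabulate suc))
                (filter⁺ _ (AllPairs.tail (allFin⁺ (suc n)))) 6≤class
... | δ , T , cxy≡δ , cxz≡δ , cyz≡δ = record
  { vertex           = lookup vertices
  ; vertex-injective = λ {s} {t} → lookup-injective vertices-unique s t
  ; spoke            = χ
  ; rim              = δ
  ; spoke-colour     = spokes
  ; rim-colour       = rims
  }
  where
  open Triple T

  inClass : ∀ {w} → w ∈ filter (λ w → entry D zero w ≟ᵇ χ) (tabulate suc) → zero ≢ w × entry D zero w ≡ χ
  inClass w∈ = let (w∈others , colour) = ∈-filter⁻ (λ w → entry D zero w ≟ᵇ χ) w∈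
               in All.lookup (AllPairs.head (allFin⁺ (suc n))) w∈others , colour

  vertices : Vec (Fin (suc n)) 4
  vertices = zero Vec.∷ x Vec.∷ y Vec.∷ z Vec.∷ Vec.[]

  vertices-unique : VecAllPairs.AllPairs _≢_ vertices
  vertices-unique =
    (proj₁ (inClass Px) VecAll.∷ proj₁ (inClass Py) VecAll.∷ proj₁ (inClass Pz) VecAll.∷ VecAll.[])
    VecAllPairs.∷ (x≢y VecAll.∷ x≢z VecAll.∷ VecAll.[])
    VecAllPairs.∷ (y≢z VecAll.∷ VecAll.[])
    VecAllPairs.∷ VecAll.[]
    VecAllPairs.∷ VecAllPairs.[]

  spokes : ∀ t → entry D zero (lookup vertices (suc t)) ≡ χ
  spokes zero             = proj₂ (inClass Px)
  spokes (suc zero)       = proj₂ (inClass Py)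
  spokes (suc (suc zero)) = proj₂ (inClass Pz)

  flip : ∀ {u v} → u ≢ v → entry D u v ≡ δ → entry D v u ≡ δ
  flip u≢v cuv≡δ = trans (symmetric D _ _ (λ eq → u≢v (sym eq))) cuv≡δ

  rims : ∀ s t → s ≢ t → entry D (lookup vertices (suc s)) (lookup vertices (suc t)) ≡ δ
  rims zero             zero             s≢t = contradiction refl s≢t
  rims zero             (suc zero)       _   = cxy≡δ
  rims zero             (suc (suc zero)) _   = cxz≡δ
  rims (suc zero)       zero             _   = flip x≢y cxy≡δ
  rims (suc zero)       (suc zero)       s≢t = contradiction refl s≢t
  rims (suc zero)       (suc (suc zero)) _   = cyz≡δ
  rims (suc (suc zero)) zero             _   = flip x≢z cxz≡δ
  rims (suc (suc zero)) (suc zero)       _   = flip y≢z cyz≡δ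
  rims (suc (suc zero)) (suc (suc zero)) s≢t = contradiction refl s≢t

corollary4p6 : (n : ℕ) → 18 ≤ n → (D : DissimilarityMatrix Bool n) →
    StarTreeRankAtMost (toℚ D) (n ∸ 3)
corollary4p6 n 18≤n D =
  n ∸ 3 , ℕ.m<n⇒0<n∸m (ℕ.≤-trans (ℕ.m≤m+n 4 14) 18≤n) , ℕ.≤-refl , trees , isMin
  where open BoundedStarCover (boundedStarCover D (12≤n⇒uniformStar (ℕ.≤-trans (ℕ.m≤m+n 12 6) 18≤n) D))
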